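{- Let $\mathbb S=\{R_0,\dots,R_d\}$ be the factorial association scheme with parameters $u_1,\dots,u_n$, and let $\mathbb U\subseteq\mathbb S$. Then $\mathbb U$ is a strongly normal closed subset of $\mathbb S$ if and only if there exists a closed subset $\mathbb V$ of $\mathbb S$ such that $\mathbb V\subseteq\mathrm O_\vartheta(\mathbb S)$, $\mathbb U=\mathrm O^\vartheta(\mathbb S)\mathbb V$, and $\mathrm O^\vartheta(\mathbb S)\cap\mathbb V=\{R_0\}$.
   Context: Let $n\ge1$ and let $\mathbb U_1,\dots,\mathbb U_n$ be finite sets with $|\mathbb U_a|=u_a\ge2$. Put $\mathbb X=\prod_a\mathbb U_a$, $d=2^n-1$. For $g\in[0,d]$ with binary expansion $g=\sum_{a=1}^n g_{(a)}2^{a-1}$ let $\mathbb P(g)=\{a:g_{(a)}=1\}$. Let $R_g=\{(\mathbf u,\mathbf v)\in\mathbb X^2:\mathbf u_a\ne\mathbf v_a\iff a\in\mathbb P(g)\}$, $\mathbb S=\{R_0,\dots,R_d\}$. For $(\mathbf u,\mathbf v)\in R_i$ let $p_{gh}^i=|\{\mathbf w:(\mathbf u,\mathbf w)\in R_g,(\mathbf w,\mathbf v)\in R_h\}|$ and $k_g=|\{\mathbf w:(\mathbf u,\mathbf w)\in R_g\}|$. For nonempty $\mathbb A,\mathbb B\subseteq\mathbb S$, $\mathbb A\mathbb B=\{R_a:\exists R_b\in\mathbb A,R_c\in\mathbb B,\ p_{bc}^a>0\}$, and $R_g\mathbb A=\{R_g\}\mathbb A$, etc. A nonempty $\mathbb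 A\subseteq\mathbb S$ is closed if $\mathbb A\mathbb A\subseteq\mathbb A$ (all relations are symmetric). A closed subset $\mathbb A$ is strongly normal in $\mathbb S$ if $R_g\mathbb AR_g\subseteq\mathbb A$ for every $R_g\in\mathbb S$. The thin residue $\mathrm O^\vartheta(\mathbb S)$ is the intersection of all strongly normal closed subsets of $\mathbb S$, and $\mathrm O_\vartheta(\mathbb S)=\{R_a:k_a=1\}$. -}

module Defs where

open import Data.Nat using (ℕ; zero; suc; _≤_; _<_; z≤n; s≤s)
open import Data.Nat.Properties using (≤-trans)
open import Data.Fin using (Fin; zero; suc; fromℕ<; _≟_)
open import Data.Fin.Subset using (Subset; _∈_; ⊥)
open import Data.Fin.Subset.Properties using (_∈?_)
open import Data.Fin.Properties using (all?)
open import Data.List using (List; []; _∷_; [_]; map; concatMap; allFin; filter; length)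
open import Data.Bool using (Bool; true; false; T; if_then_else_)
open import Data.Product using (Σ; ∃; _×_; _,_)
open import Relation.Nullary using (¬_; Dec; yes; no)
open import Relation.Nullary.Decidable using (_×-dec_; _→-dec_; ¬?; ⌊_⌋)
open import Relation.Binary.PropositionalEquality using (_≡_; _≢_)

Pt : (n : ℕ) → (Fin n → ℕ) → Set
Pt n u = (a : Fin n) → Fin (u a)

consPt : {n : ℕ} {u : Fin (suc n) → ℕ} → Fin (u zero) → ((a : Fin n) → Fin (u (suc a))) → Pt (suc n) u
consPt i f zero = i
consPt i f (suc a) = f a

allPts : (n : ℕ) (u : Fin n → ℕ) → List (Pt n u)
allPts zero u = [ (λ ()) ]
allPts (suc n) u = concatMap (λ i → map (consPt i) (allPts n (λ a → u (suc a)))) (allFin (u zero))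

countPts : (n : ℕ) (u : Fin n → ℕ) {P : Pt n u → Set} → ((w : Pt n u) → Dec (P w)) → ℕ
countPts n u P? = length (filter P? (allPts n u))

-- The relations are indexed by g ∈ [0,d]; we index R_g directly by ℙ(g) ⊆ {1..n},
-- i.e. by a Subset n (the binary expansion g ↦ ℙ(g) is a bijection [0,d] ≅ Subset n).
-- (u,v) ∈ R_g  iff  for all a,  u_a ≠ v_a ⇔ a ∈ ℙ(g).
InRel : {n : ℕ} {u : Fin n → ℕ} → Subset n → Pt n u → Pt n u → Set
InRel g x y = ∀ a → ((x a ≢ y a → a ∈ g) × (a ∈ g → x a ≢ y a))

inRel? : {n : ℕ} {u : Fin n → ℕ} (g : Subset n) (x y : Pt n u) → Dec (InRel g x y)
inRel? g x y = all? (λ a → (¬? (x a ≟ y a) →-dec (a ∈? g)) ×-dec ((a ∈? g) →-dec ¬? (x a ≟ y a)))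

-- A subset of 𝕊 (a set of relations), given by its (decidable) membership on indices.
RelSet : ℕ → Set
RelSet n = Subset n → Bool

module Scheme (n : ℕ) (u : Fin n → ℕ) (hu : ∀ a → 2 ≤ u a) where

  𝕏 : Set
  𝕏 = Pt n u

  R : Subset n → 𝕏 → 𝕏 → Set
  R g = InRel g

  R₀ : Subset n
  R₀ = ⊥

  -- A canonical pair (base , pt i) ∈ R_i, used to evaluate p_{gh}^i and k_g
  -- (these numbers do not depend on the chosen pair in the scheme).
  base : 𝕏
  base a = fromℕ< {0} (≤-trans (s≤s z≤n) (hu a))

  pt : Subset n → 𝕏
  pt i a with a ∈? i
  ... | yes _ = fromℕ< {1} (hu a)
  ... | no _  = fromℕ< {0} (≤-trans (s≤s z≤n) (hu a))

  p : Subset n → Subset n → Subset n → ℕ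
  p g h i = countPts n u (λ w → inRel? g (base) w ×-dec inRel? h w (pt i))

  k : Subset n → ℕ
  k g = countPts n u (λ w → inRel? g base w)

  _·_ : (Subset n → Set) → (Subset n → Set) → (Subset n → Set)
  (A · B) a = ∃ λ b → ∃ λ c → A b × B c × 0 < p b c a

  ⟦_⟧ : RelSet n → (Subset n → Set)
  ⟦ A ⟧ g = T (A g)

  ｛_｝ : Subset n → (Subset n → Set)
  ｛ g ｝ h = h ≡ g

  Nonempty : RelSet n → Set
  Nonempty A = ∃ λ g → T (A g)

  Closed : RelSet n → Set
  Closed A = Nonempty A × (∀ a → (⟦ A ⟧ · ⟦ A ⟧) a → T (A a))

  StronglyNormalClosed : RelSet n → Set
  StronglyNormalClosed A = Closed A × (∀ g a → ((｛ g ｝ · ⟦ A ⟧) · ｛ g ｝) a → T (A a))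

  Oϑ^ : Subset n → Set
  Oϑ^ g = (A : RelSet n) → StronglyNormalClosed A → T (A g)

  Oϑ_ : Subset n → Set
  Oϑ_ g = k g ≡ 1

{-# OPTIONS --safe #-}
module Submission where

-- The factorial scheme is the direct product of the trivial schemes {=, ≠} on the 𝕌_a, so
-- p^i_{gh} > 0 iff at every coordinate a either i_a = g_a xor h_a, or g_a = h_a = i_a = 1 and
-- u_a ≥ 3.  Call the coordinates with u_a ≥ 3 thick.  Then R_i ∈ R_g R_h forces
-- thinPart i = thinPart g ⊕ thinPart h, and R_{g ⊕ h} ∈ R_g R_h always, so thinPart is a
-- homomorphism onto the Boolean group of sets of thin coordinates.  Its kernel, the relations
-- supported on thick coordinates, is the thin residue; as k_g = ∏_{a ∈ g} (u_a − 1), the thin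
-- radical consists of the relations supported on thin coordinates.  So the strongly normal
-- closed subsets are the preimages of subgroups under thinPart, and such a preimage U equals
-- O^ϑ(𝕊) V for V = U ∩ O_ϑ(𝕊), since g = thickPart g ⊕ thinPart g.

open import Defs
open import Data.Nat using (ℕ; zero; suc; _+_; _*_; _∸_; _≤_; _<_; _≤ᵇ_; z≤n; s≤s)
open import Data.Nat.Properties using (m*n≡1⇒m≡1; m*n≡1⇒n≡1; ≤ᵇ-reflects-≤; 0≢1+n)
open import Data.Bool using (Bool; true; false; T; not; _∧_; _xor_)
import Data.Bool as Bool
open import Data.Bool.Properties using (∧-distribʳ-xor; xor-is-ok; T-∧)
open import Data.Fin using (Fin; zero; suc; _≟_; toℕ; fromℕ<)
open import Data.Fin.Properties using (toℕ-fromℕ<)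
open import Data.Fin.Subset using (Subset; ⊥; ⊤; _∩_; _∪_; ∁; _∈_; _∉_; ⁅_⁆; ∣_∣)
open import Data.Fin.Subset.Properties
  using ( _∈?_; drop-there; x∈⁅y⁆⇔x≡y; x∈∁p⇒x∉p; x∉p⇒x∈∁p; ∣⁅x⁆∣≡1; ∣∁p∣≡n∸∣p∣
        ; ∪-∩-booleanAlgebra; ∩-assoc; ∩-zeroˡ; ∩-zeroʳ; ∩-identityʳ; ∩-inverseʳ; ∩-inverseˡ)
open import Data.List using (List; []; _∷_; _++_; map; concatMap; allFin; filter; length; tabulate)
open import Data.List.Properties
  using (filter-++; length-++; filter-some; filter-≐; filter-none; map-tabulate)
open import Data.List.Relation.Unary.All as All using (All; _∷_)
open import Data.List.Relation.Unary.All.Properties using (all-filter)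
open import Data.List.Relation.Unary.Any as Any using (Any; here)
open import Data.List.Relation.Unary.Any.Properties using (concatMap⁺; map⁺)
open import Data.List.Membership.Propositional.Properties using (∈-allFin)
open import Data.Product using (Σ; ∃; _×_; _,_; proj₁; proj₂)
open import Data.Vec using ([]; _∷_; lookup; zipWith; there)
import Data.Vec as Vec
open import Data.Vec.Properties
  using ( lookup-zipWith; lookup-map; lookup-replicate; lookup∘tabulate; []=⇒lookup; lookup⇒[]=
        ; ∷-injectiveˡ; ∷-injectiveʳ; ≡-dec)
open import Data.Vec.Relation.Binary.Pointwise.Extensional using (ext; Pointwise-≡⇒≡)
open import Function using (id; _∘_; _⇔_; mk⇔; Equivalence)
open import Relation.Nullary using (¬_; Dec; yes; no; does; contradiction)
open import Relation.Nullary.Decidable using (⌊_⌋; _×-dec_; dec-true; dec-false; toWitness; fromWitness)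
open import Relation.Nullary.Reflects using (Reflects; ofʸ; ofⁿ; invert)
open import Relation.Binary.PropositionalEquality
  using (_≡_; _≢_; refl; sym; trans; cong; cong₂; subst; module ≡-Reasoning)

open Equivalence using (to; from)

-- Feasible t x y z says p^z_{xy} > 0 in the trivial scheme (false = equality, true = inequality)
-- on a set of at least two points, which has a third point iff t.
data Feasible : Bool → Bool → Bool → Bool → Set where
  xor-feasible : ∀ {t} x y → Feasible t x y (x xor y)
  triangle     : Feasible true true true true

module _ {t x y z : Bool} where

  feasible-thin : Feasible t x y z → z ∧ not t ≡ (x ∧ not t) xor (y ∧ not t)
  feasible-thin (xor-feasible x y) = ∧-distribʳ-xor (not t) x y
  feasible-thin triangle           = refl

  feasible-thick : Feasible t x y z → x ∧ t ≡ false → y ∧ t ≡ false → z ∧ t ≡ false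
  feasible-thick (xor-feasible x y) x∧t≡false y∧t≡false = begin
    (x xor y) ∧ t       ≡⟨ ∧-distribʳ-xor t x y ⟩
    (x ∧ t) xor (y ∧ t) ≡⟨ cong₂ _xor_ x∧t≡false y∧t≡false ⟩
    false               ∎
    where open ≡-Reasoning
  feasible-thick triangle ()

feasible-diagonal : ∀ {t} x → x ∧ not t ≡ false → Feasible t x x x
feasible-diagonal        false _ = xor-feasible false false
feasible-diagonal {true} true  _ = triangle

infixl 6 _⊕_

_⊕_ : ∀ {n} → Subset n → Subset n → Subset n
p ⊕ q = zipWith _xor_ p q

⊕-def : ∀ {n} (p q : Subset n) → p ⊕ q ≡ (p ∪ q) ∩ ∁ (p ∩ q)
⊕-def []      []      = refl
⊕-def (x ∷ p) (y ∷ q) = cong₂ _∷_ (xor-is-ok x y) (⊕-def p q)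

module _ {n : ℕ} where

  open import Algebra.Lattice.Properties.BooleanAlgebra (∪-∩-booleanAlgebra n)
    using (module XorRing; ¬⊥≈⊤)
  open XorRing _⊕_ ⊕-def public using (⊕-comm; ⊕-assoc; ⊕-identityˡ; ⊕-identityʳ; ⊕-inverseˡ)
  open XorRing _⊕_ ⊕-def using (∧-distribˡ-⊕; ¬-distribʳ-⊕)
  open ≡-Reasoning

  p⊕q⊕p≡q : ∀ (p q : Subset n) → p ⊕ q ⊕ p ≡ q
  p⊕q⊕p≡q p q = begin
    p ⊕ q ⊕ p   ≡⟨ cong (_⊕ p) (⊕-comm p q) ⟩
    q ⊕ p ⊕ p   ≡⟨ ⊕-assoc q p p ⟩
    q ⊕ (p ⊕ p) ≡⟨ cong (q ⊕_) (⊕-inverseˡ p) ⟩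
    q ⊕ ⊥       ≡⟨ ⊕-identityʳ q ⟩
    q           ∎

  p∩m⊕p∩∁m≡p : ∀ (p m : Subset n) → p ∩ m ⊕ p ∩ ∁ m ≡ p
  p∩m⊕p∩∁m≡p p m = begin
    p ∩ m ⊕ p ∩ ∁ m ≡⟨ ∧-distribˡ-⊕ p m (∁ m) ⟨
    p ∩ (m ⊕ ∁ m)   ≡⟨ cong (p ∩_) (¬-distribʳ-⊕ m m) ⟨
    p ∩ ∁ (m ⊕ m)   ≡⟨ cong (λ q → p ∩ ∁ q) (⊕-inverseˡ m) ⟩
    p ∩ ∁ ⊥         ≡⟨ cong (p ∩_) ¬⊥≈⊤ ⟩
    p ∩ ⊤           ≡⟨ ∩-identityʳ p ⟩
    p               ∎

  p∩m∩∁m≡⊥ : ∀ (p m : Subset n) → (p ∩ m) ∩ ∁ m ≡ ⊥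
  p∩m∩∁m≡⊥ p m = begin
    (p ∩ m) ∩ ∁ m ≡⟨ ∩-assoc p m (∁ m) ⟩
    p ∩ (m ∩ ∁ m) ≡⟨ cong (p ∩_) (∩-inverseʳ m) ⟩
    p ∩ ⊥         ≡⟨ ∩-zeroʳ p ⟩
    ⊥             ∎

  p∩∁m∩m≡⊥ : ∀ (p m : Subset n) → (p ∩ ∁ m) ∩ m ≡ ⊥
  p∩∁m∩m≡⊥ p m = begin
    (p ∩ ∁ m) ∩ m ≡⟨ ∩-assoc p (∁ m) m ⟩
    p ∩ (∁ m ∩ m) ≡⟨ cong (p ∩_) (∩-inverseˡ m) ⟩
    p ∩ ⊥         ≡⟨ ∩-zeroʳ p ⟩
    ⊥             ∎

  p∩m⊕p≡p∩∁m : ∀ (p m : Subset n) → p ∩ m ⊕ p ≡ p ∩ ∁ m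
  p∩m⊕p≡p∩∁m p m = begin
    p ∩ m ⊕ p                   ≡⟨ cong (p ∩ m ⊕_) (p∩m⊕p∩∁m≡p p m) ⟨
    p ∩ m ⊕ (p ∩ m ⊕ p ∩ ∁ m)   ≡⟨ ⊕-assoc (p ∩ m) (p ∩ m) (p ∩ ∁ m) ⟨
    p ∩ m ⊕ p ∩ m ⊕ p ∩ ∁ m     ≡⟨ cong (_⊕ p ∩ ∁ m) (⊕-inverseˡ (p ∩ m)) ⟩
    ⊥ ⊕ p ∩ ∁ m                 ≡⟨ ⊕-identityˡ (p ∩ ∁ m) ⟩
    p ∩ ∁ m                     ∎

  p∩m≡⊥⇒p∩∁m≡p : ∀ {p m : Subset n} → p ∩ m ≡ ⊥ → p ∩ ∁ m ≡ p
  p∩m≡⊥⇒p∩∁m≡p {p} {m} p∩m≡⊥ = begin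
    p ∩ ∁ m         ≡⟨ ⊕-identityˡ (p ∩ ∁ m) ⟨
    ⊥ ⊕ p ∩ ∁ m     ≡⟨ cong (_⊕ p ∩ ∁ m) p∩m≡⊥ ⟨
    p ∩ m ⊕ p ∩ ∁ m ≡⟨ p∩m⊕p∩∁m≡p p m ⟩
    p               ∎

  p∩m≡⊥⇒p∩∁m≡⊥⇒p≡⊥ : ∀ {p m : Subset n} → p ∩ m ≡ ⊥ → p ∩ ∁ m ≡ ⊥ → p ≡ ⊥
  p∩m≡⊥⇒p∩∁m≡⊥⇒p≡⊥ {p} {m} p∩m≡⊥ p∩∁m≡⊥ = begin
    p               ≡⟨ p∩m⊕p∩∁m≡p p m ⟨
    p ∩ m ⊕ p ∩ ∁ m ≡⟨ cong₂ _⊕_ p∩m≡⊥ p∩∁m≡⊥ ⟩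
    ⊥ ⊕ ⊥           ≡⟨ ⊕-identityˡ ⊥ ⟩
    ⊥               ∎

  FeasibleTriple : Subset n → Subset n → Subset n → Subset n → Set
  FeasibleTriple m g h i = ∀ a → Feasible (lookup m a) (lookup g a) (lookup h a) (lookup i a)

  private
    lookup-∩ : ∀ (p m : Subset n) a → lookup (p ∩ m) a ≡ lookup p a ∧ lookup m a
    lookup-∩ p m a = lookup-zipWith _∧_ a p m

    lookup-∩∁ : ∀ (p m : Subset n) a → lookup (p ∩ ∁ m) a ≡ lookup p a ∧ not (lookup m a)
    lookup-∩∁ p m a = trans (lookup-∩ p (∁ m) a) (cong (lookup p a ∧_) (lookup-map a not m))

    lookup-≡⊥ : ∀ {p : Subset n} → p ≡ ⊥ → ∀ a → lookup p a ≡ false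
    lookup-≡⊥ refl a = lookup-replicate a false

  FeasibleTriple-⊕ : ∀ m g h → FeasibleTriple m g h (g ⊕ h)
  FeasibleTriple-⊕ m g h a =
    subst (Feasible _ _ _) (sym (lookup-zipWith _xor_ a g h)) (xor-feasible _ _)

  FeasibleTriple-thin : ∀ {m g h i} → FeasibleTriple m g h i → i ∩ ∁ m ≡ g ∩ ∁ m ⊕ h ∩ ∁ m
  FeasibleTriple-thin {m} {g} {h} {i} feasible = Pointwise-≡⇒≡ (ext λ a → begin
    lookup (i ∩ ∁ m) a                        ≡⟨ lookup-∩∁ i m a ⟩
    lookup i a ∧ not (lookup m a)             ≡⟨ feasible-thin (feasible a) ⟩
    (lookup g a ∧ not (lookup m a)) xor (lookup h a ∧ not (lookup m a))
                                              ≡⟨ cong₂ _xor_ (lookup-∩∁ g m a) (lookup-∩∁ h m a) ⟨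
    lookup (g ∩ ∁ m) a xor lookup (h ∩ ∁ m) a ≡⟨ lookup-zipWith _xor_ a (g ∩ ∁ m) (h ∩ ∁ m) ⟨
    lookup (g ∩ ∁ m ⊕ h ∩ ∁ m) a              ∎)

  FeasibleTriple-thick : ∀ {m g h i} → FeasibleTriple m g h i →
                         g ∩ m ≡ ⊥ → h ∩ m ≡ ⊥ → i ∩ m ≡ ⊥
  FeasibleTriple-thick {m} {g} {h} {i} feasible g∩m≡⊥ h∩m≡⊥ = Pointwise-≡⇒≡ (ext λ a → begin
    lookup (i ∩ m) a        ≡⟨ lookup-∩ i m a ⟩
    lookup i a ∧ lookup m a ≡⟨ feasible-thick (feasible a) (free g∩m≡⊥ a) (free h∩m≡⊥ a) ⟩
    false                   ≡⟨ lookup-replicate a false ⟨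
    lookup ⊥ a              ∎)
    where
    free : ∀ {p} → p ∩ m ≡ ⊥ → ∀ a → lookup p a ∧ lookup m a ≡ false
    free {p} p∩m≡⊥ a = trans (sym (lookup-∩ p m a)) (lookup-≡⊥ p∩m≡⊥ a)

  FeasibleTriple-diagonal : ∀ {m g} → g ∩ ∁ m ≡ ⊥ → FeasibleTriple m g g g
  FeasibleTriple-diagonal {m} {g} g∩∁m≡⊥ a =
    feasible-diagonal (lookup g a) (trans (sym (lookup-∩∁ g m a)) (lookup-≡⊥ g∩∁m≡⊥ a))

differ : ∀ {m} → Fin m → Fin m → Bool
differ o w = not (does (o ≟ w))

three-distinct⇒3≤ : ∀ {m} {o w q : Fin m} → o ≢ w → w ≢ q → o ≢ q → 3 ≤ m
three-distinct⇒3≤ {suc (suc (suc _))} _ _ _ = s≤s (s≤s (s≤s z≤n))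
three-distinct⇒3≤ {1} {zero}     {zero}     o≢w _ _ = contradiction refl o≢w
three-distinct⇒3≤ {2} {zero}     {zero}     o≢w _ _ = contradiction refl o≢w
three-distinct⇒3≤ {2} {suc zero} {suc zero} o≢w _ _ = contradiction refl o≢w
three-distinct⇒3≤ {2} {zero}     {suc zero} {zero}     _ _   o≢q = contradiction refl o≢q
three-distinct⇒3≤ {2} {zero}     {suc zero} {suc zero} _ w≢q _   = contradiction refl w≢q
three-distinct⇒3≤ {2} {suc zero} {zero}     {zero}     _ w≢q _   = contradiction refl w≢q
three-distinct⇒3≤ {2} {suc zero} {zero}     {suc zero} _ _   o≢q = contradiction refl o≢q

module _ {m : ℕ} where

  differ-≡ : {o w : Fin m} → o ≡ w → differ o w ≡ false
  differ-≡ {o} {w} o≡w = cong not (dec-true (o ≟ w) o≡w)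

  differ-≢ : {o w : Fin m} → o ≢ w → differ o w ≡ true
  differ-≢ {o} {w} o≢w = cong not (dec-false (o ≟ w) o≢w)

  differ≡false⇒≡ : {o w : Fin m} → differ o w ≡ false → o ≡ w
  differ≡false⇒≡ {o} {w} _ with yes o≡w ← o ≟ w = o≡w

  differ≡true⇒≢ : {o w : Fin m} → differ o w ≡ true → o ≢ w
  differ≡true⇒≢ {o} {w} _ with no o≢w ← o ≟ w = o≢w

  other-point : 2 ≤ m → (o : Fin m) → ∃ λ w → o ≢ w
  other-point (s≤s (s≤s _)) zero    = suc zero , λ ()
  other-point (s≤s (s≤s _)) (suc _) = zero , λ ()

  third-point : 3 ≤ m → (o q : Fin m) → ∃ λ w → o ≢ w × w ≢ q
  third-point (s≤s (s≤s (s≤s _))) zero          zero          = suc zero , (λ ()) , (λ ())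
  third-point (s≤s (s≤s (s≤s _))) zero          (suc zero)    = suc (suc zero) , (λ ()) , (λ ())
  third-point (s≤s (s≤s (s≤s _))) zero          (suc (suc _)) = suc zero , (λ ()) , (λ ())
  third-point (s≤s (s≤s (s≤s _))) (suc zero)    zero          = suc (suc zero) , (λ ()) , (λ ())
  third-point (s≤s (s≤s (s≤s _))) (suc zero)    (suc _)       = zero , (λ ()) , (λ ())
  third-point (s≤s (s≤s (s≤s _))) (suc (suc _)) zero          = suc zero , (λ ()) , (λ ())
  third-point (s≤s (s≤s (s≤s _))) (suc (suc _)) (suc _)       = zero , (λ ()) , (λ ())

  triangle-of : ∀ {t} → Reflects (3 ≤ m) t → 3 ≤ m → Feasible t true true true
  triangle-of (ofʸ _)   _   = triangle
  triangle-of (ofⁿ 3≰m) 3≤m = contradiction 3≤m 3≰m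

  module _ {t : Bool} (3≤m-reflects : Reflects (3 ≤ m) t) where

    differ-feasible : ∀ (o w q : Fin m) {x y z} →
                      x ≡ differ o w → y ≡ differ w q → z ≡ differ o q → Feasible t x y z
    differ-feasible o w q refl refl refl with o ≟ w | w ≟ q | o ≟ q
    ... | yes _    | yes _    | yes _    = xor-feasible false false
    ... | yes _    | no _     | no _     = xor-feasible false true
    ... | no _     | yes _    | no _     = xor-feasible true false
    ... | no _     | no _     | yes _    = xor-feasible true true
    ... | no o≢w   | no w≢q   | no o≢q   = triangle-of 3≤m-reflects (three-distinct⇒3≤ o≢w w≢q o≢q)
    ... | yes refl | yes refl | no o≢q   = contradiction refl o≢q
    ... | yes refl | no w≢q   | yes refl = contradiction refl w≢q
    ... | no o≢w   | yes refl | yes refl = contradiction refl o≢w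

    feasible-realised : 2 ≤ m → ∀ (o q : Fin m) {x y z} → Feasible t x y z → z ≡ differ o q →
                        ∃ λ w → x ≡ differ o w × y ≡ differ w q
    feasible-realised _ o _ (xor-feasible false _) y≡differ =
      o , sym (differ-≡ {o} refl) , y≡differ
    feasible-realised _ _ q (xor-feasible true false) true≡differ =
      q , true≡differ , sym (differ-≡ {q} refl)
    feasible-realised 2≤m o q (xor-feasible true true) false≡differ
      with refl ← differ≡false⇒≡ {o} {q} (sym false≡differ) | w , o≢w ← other-point 2≤m o
      = w , sym (differ-≢ o≢w) , sym (differ-≢ (o≢w ∘ sym))
    feasible-realised _ o q triangle _
      with w , o≢w , w≢q ← third-point (invert 3≤m-reflects) o q
      = w , sym (differ-≢ o≢w) , sym (differ-≢ w≢q)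

neighbours : ∀ {m} → Bool → Fin m → Subset m
neighbours false o = ⁅ o ⁆
neighbours true  o = ∁ ⁅ o ⁆

module _ {m : ℕ} where

  ∈-neighbours⇔ : ∀ {x} {o j : Fin m} → j ∈ neighbours x o ⇔ x ≡ differ o j
  ∈-neighbours⇔ {false} = mk⇔
    (λ j∈⁅o⁆ → sym (differ-≡ (sym (to x∈⁅y⁆⇔x≡y j∈⁅o⁆))))
    (λ false≡differ → from x∈⁅y⁆⇔x≡y (sym (differ≡false⇒≡ (sym false≡differ))))
  ∈-neighbours⇔ {true} = mk⇔
    (λ j∈∁⁅o⁆ → sym (differ-≢ (λ o≡j → x∈∁p⇒x∉p j∈∁⁅o⁆ (from x∈⁅y⁆⇔x≡y (sym o≡j)))))
    (λ true≡differ → x∉p⇒x∈∁p λ j∈⁅o⁆ →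
      differ≡true⇒≢ (sym true≡differ) (sym (to x∈⁅y⁆⇔x≡y j∈⁅o⁆)))

  ∣∁⁅x⁆∣≡n∸1 : (o : Fin m) → ∣ ∁ ⁅ o ⁆ ∣ ≡ m ∸ 1
  ∣∁⁅x⁆∣≡n∸1 o = trans (∣∁p∣≡n∸∣p∣ ⁅ o ⁆) (cong (m ∸_) (∣⁅x⁆∣≡1 o))

∣neighbours∣≡1⇔ : ∀ {m} x (o : Fin m) → 2 ≤ m → ∣ neighbours x o ∣ ≡ 1 ⇔ x ∧ (3 ≤ᵇ m) ≡ false
∣neighbours∣≡1⇔                      false o _ = mk⇔ (λ _ → refl) (λ _ → ∣⁅x⁆∣≡1 o)
∣neighbours∣≡1⇔ {1}                  true  o (s≤s ())
∣neighbours∣≡1⇔ {2}                  true  o _ = mk⇔ (λ _ → refl) (λ _ → ∣∁⁅x⁆∣≡n∸1 o)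
∣neighbours∣≡1⇔ {suc (suc (suc _))} true  o _ =
  mk⇔ (λ ∣∁⁅o⁆∣≡1 → contradiction (trans (sym (∣∁⁅x⁆∣≡n∸1 o)) ∣∁⁅o⁆∣≡1) λ ()) λ ()

∉⇒lookup≡false : ∀ {n} {g : Subset n} {a} → a ∉ g → lookup g a ≡ false
∉⇒lookup≡false {g = g} {a} a∉g with lookup g a in g[a]≡
... | true  = contradiction (lookup⇒[]= a g g[a]≡) a∉g
... | false = refl

module _ {m n : ℕ} {g : Subset n} {a : Fin n} {o w : Fin m} where

  InRel-coordinate⇔ : ((o ≢ w → a ∈ g) × (a ∈ g → o ≢ w)) ⇔ lookup g a ≡ differ o w
  InRel-coordinate⇔ with o ≟ w
  ... | yes o≡w = mk⇔ (λ (_ , ∈⇒≢) → ∉⇒lookup≡false (λ a∈g → ∈⇒≢ a∈g o≡w))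
    (λ g[a]≡false → (λ o≢w → contradiction o≡w o≢w) ,
                    (λ a∈g → contradiction (trans (sym ([]=⇒lookup a∈g)) g[a]≡false) λ ()))
  ... | no o≢w = mk⇔ (λ (≢⇒∈ , _) → []=⇒lookup (≢⇒∈ o≢w))
    (λ g[a]≡true → (λ _ → lookup⇒[]= a g g[a]≡true) , (λ _ → o≢w))

module _ {n : ℕ} {u : Fin n → ℕ} where

  infix 4 _≋_
  _≋_ : Pt n u → Pt n u → Set
  w ≋ w′ = ∀ a → w a ≡ w′ a

  InRel⇔ : ∀ {g : Subset n} {x y : Pt n u} → InRel g x y ⇔ (∀ a → lookup g a ≡ differ (x a) (y a))
  InRel⇔ = mk⇔ (λ r a → to InRel-coordinate⇔ (r a)) (λ e a → from InRel-coordinate⇔ (e a))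

  InRel-resp : ∀ {g : Subset n} {x x′ y y′ : Pt n u} →
               x ≋ x′ → y ≋ y′ → InRel g x y → InRel g x′ y′
  InRel-resp x≋x′ y≋y′ r =
    from InRel⇔ λ a → trans (to InRel⇔ r a) (cong₂ differ (x≋x′ a) (y≋y′ a))

InRel-cons⇔ : ∀ {n} {u : Fin (suc n) → ℕ} {x g} {b : Pt (suc n) u} {j f} →
  InRel (x ∷ g) b (consPt j f) ⇔ (j ∈ neighbours x (b zero) × InRel g (b ∘ suc) f)
InRel-cons⇔ = mk⇔
  (λ r → from ∈-neighbours⇔ (to InRel⇔ r zero) , from InRel⇔ (to InRel⇔ r ∘ suc))
  (λ (j∈ , r) → from InRel⇔ λ { zero → to ∈-neighbours⇔ j∈ ; (suc a) → to InRel⇔ r a })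

allPts-complete : ∀ n u (w : Pt n u) → Any (_≋ w) (allPts n u)
allPts-complete zero    u w = here λ ()
allPts-complete (suc n) u w = concatMap⁺ _ (Any.map completions (∈-allFin (w zero)))
  where
  completions : ∀ {j} → w zero ≡ j → Any (_≋ w) (map (consPt j) (allPts n (u ∘ suc)))
  completions refl = map⁺ (Any.map (λ f≋w∘suc → λ { zero → refl ; (suc a) → f≋w∘suc a })
                                   (allPts-complete n (u ∘ suc) (w ∘ suc)))

module _ {n : ℕ} {u : Fin n → ℕ} {P : Pt n u → Set} (P? : ∀ w → Dec (P w)) where

  countPts-positive⇔ : (∀ {w w′} → w ≋ w′ → P w → P w′) → 0 < countPts n u P? ⇔ ∃ P
  countPts-positive⇔ resp = mk⇔ (witness (all-filter P? (allPts n u))) λ (w , Pw) →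
    filter-some P? (Any.map (λ w′≋w → resp (sym ∘ w′≋w) Pw) (allPts-complete n u w))
    where
    witness : ∀ {ws} → All P ws → 0 < length ws → ∃ P
    witness (Pw ∷ _) _ = _ , Pw

length-filter-map : ∀ {A B : Set} {P : B → Set} (P? : ∀ y → Dec (P y)) (f : A → B) xs →
                    length (filter P? (map f xs)) ≡ length (filter (P? ∘ f) xs)
length-filter-map P? f []       = refl
length-filter-map P? f (x ∷ xs) with does (P? (f x))
... | true  = cong suc (length-filter-map P? f xs)
... | false = length-filter-map P? f xs

length-filter-∈?-suc : ∀ {m} x (p : Subset m) →
  length (filter (_∈? (x ∷ p)) (tabulate suc)) ≡ length (filter (_∈? p) (allFin m))
length-filter-∈?-suc x p = begin
  length (filter (_∈? (x ∷ p)) (tabulate suc))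
    ≡⟨ cong (length ∘ filter (_∈? (x ∷ p))) (map-tabulate id suc) ⟨
  length (filter (_∈? (x ∷ p)) (map suc (allFin _)))
    ≡⟨ length-filter-map (_∈? (x ∷ p)) suc (allFin _) ⟩
  length (filter ((_∈? (x ∷ p)) ∘ suc) (allFin _))
    ≡⟨ cong length (filter-≐ _ (_∈? p) (drop-there , there) (allFin _)) ⟩
  length (filter (_∈? p) (allFin _))
    ∎
  where open ≡-Reasoning

∣p∣≡length-filter : ∀ {m} (p : Subset m) → ∣ p ∣ ≡ length (filter (_∈? p) (allFin m))
∣p∣≡length-filter []          = refl
∣p∣≡length-filter (true  ∷ p) =
  cong suc (trans (∣p∣≡length-filter p) (sym (length-filter-∈?-suc true p)))
∣p∣≡length-filter (false ∷ p) =
  trans (∣p∣≡length-filter p) (sym (length-filter-∈?-suc false p))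

module _ {n : ℕ} {u : Fin (suc n) → ℕ} {P : Pt (suc n) u → Set} {Q : Pt n (u ∘ suc) → Set}
         (P? : ∀ w → Dec (P w)) (Q? : ∀ f → Dec (Q f)) (s : Subset (u zero))
         (P⇔ : ∀ j f → P (consPt j f) ⇔ (j ∈ s × Q f)) where

  private
    tails : List (Pt n (u ∘ suc))
    tails = allPts n (u ∘ suc)

    fibre : Fin (u zero) → List (Pt (suc n) u)
    fibre j = map (consPt j) tails

    length-filter-fibre-∈ : ∀ {j} → j ∈ s → length (filter P? (fibre j)) ≡ countPts n (u ∘ suc) Q?
    length-filter-fibre-∈ {j} j∈s = trans (length-filter-map P? (consPt j) tails)
      (cong length (filter-≐ (P? ∘ consPt j) Q? (P⊆Q , Q⊆P) tails))
      where
      P⊆Q : ∀ {f} → P (consPt j f) → Q f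
      P⊆Q = proj₂ ∘ to (P⇔ j _)
      Q⊆P : ∀ {f} → Q f → P (consPt j f)
      Q⊆P Qf = from (P⇔ j _) (j∈s , Qf)

    length-filter-fibre-∉ : ∀ {j} → j ∉ s → length (filter P? (fibre j)) ≡ 0
    length-filter-fibre-∉ {j} j∉s = trans (length-filter-map P? (consPt j) tails)
      (cong length (filter-none (P? ∘ consPt j) (All.universal ¬P tails)))
      where
      ¬P : ∀ f → ¬ P (consPt j f)
      ¬P f = j∉s ∘ proj₁ ∘ to (P⇔ j f)

    length-filter-++ : ∀ j js → length (filter P? (fibre j ++ concatMap fibre js)) ≡
                                length (filter P? (fibre j)) + length (filter P? (concatMap fibre js))
    length-filter-++ j js =
      trans (cong length (filter-++ P? (fibre j) _)) (length-++ (filter P? (fibre j)))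

    length-filter-fibres : ∀ js → length (filter P? (concatMap fibre js)) ≡
                                  length (filter (_∈? s) js) * countPts n (u ∘ suc) Q?
    length-filter-fibres []       = refl
    length-filter-fibres (j ∷ js) with j ∈? s
    ... | yes j∈s = trans (length-filter-++ j js)
                          (cong₂ _+_ (length-filter-fibre-∈ j∈s) (length-filter-fibres js))
    ... | no j∉s  = trans (length-filter-++ j js)
                          (cong₂ _+_ (length-filter-fibre-∉ j∉s) (length-filter-fibres js))

  countPts-cons : countPts (suc n) u P? ≡ ∣ s ∣ * countPts n (u ∘ suc) Q?
  countPts-cons = trans (length-filter-fibres (allFin _)) (cong (_* _) (sym (∣p∣≡length-filter s)))

valency : ∀ {n} {u : Fin n → ℕ} → Pt n u → Subset n → ℕ
valency {n} {u} b g = countPts n u (inRel? g b)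

thick : ∀ {n} → (Fin n → ℕ) → Subset n
thick u = Vec.tabulate (λ a → 3 ≤ᵇ u a)

valency≡1⇔ : ∀ {n} {u : Fin n → ℕ} → (∀ a → 2 ≤ u a) → (b : Pt n u) (g : Subset n) →
             valency b g ≡ 1 ⇔ g ∩ thick u ≡ ⊥
valency≡1⇔ {zero}  _   b []      = mk⇔ (λ _ → refl) (λ _ → refl)
valency≡1⇔ {suc n} {u} 2≤u b (x ∷ g) = mk⇔
  (λ v≡1 → cong₂ _∷_ (to head≡1⇔ (m*n≡1⇒m≡1 _ (valency (b ∘ suc) g) (trans (sym split) v≡1)))
                     (to tail≡1⇔ (m*n≡1⇒n≡1 ∣ neighbours x (b zero) ∣ _ (trans (sym split) v≡1))))
  (λ eq → trans split
    (cong₂ _*_ (from head≡1⇔ (∷-injectiveˡ eq)) (from tail≡1⇔ (∷-injectiveʳ eq))))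
  where
  split : valency b (x ∷ g) ≡ ∣ neighbours x (b zero) ∣ * valency (b ∘ suc) g
  split = countPts-cons (inRel? (x ∷ g) b) (inRel? g (b ∘ suc)) (neighbours x (b zero))
                        λ _ _ → InRel-cons⇔
  head≡1⇔ : ∣ neighbours x (b zero) ∣ ≡ 1 ⇔ x ∧ (3 ≤ᵇ u zero) ≡ false
  head≡1⇔ = ∣neighbours∣≡1⇔ x (b zero) (2≤u zero)
  tail≡1⇔ : valency (b ∘ suc) g ≡ 1 ⇔ g ∩ thick (u ∘ suc) ≡ ⊥
  tail≡1⇔ = valency≡1⇔ (2≤u ∘ suc) (b ∘ suc) g

module FactorialScheme (n : ℕ) (u : Fin n → ℕ) (hu : ∀ a → 2 ≤ u a) where

  open Scheme n u hu

  thinPart thickPart : Subset n → Subset n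
  thinPart  g = g ∩ ∁ (thick u)
  thickPart g = g ∩ thick u

  thick-reflects : ∀ a → Reflects (3 ≤ u a) (lookup (thick u) a)
  thick-reflects a = subst (Reflects _) (sym (lookup∘tabulate _ a)) (≤ᵇ-reflects-≤ 3 (u a))

  pt-differs : ∀ i a → lookup i a ≡ differ (base a) (pt i a)
  pt-differs i a with a ∈? i
  ... | yes a∈i = trans ([]=⇒lookup a∈i) (sym (differ-≢ {o = base a} base≢one))
    where
    base≢one : base a ≢ fromℕ< (hu a)
    base≢one base≡one =
      0≢1+n (trans (sym (toℕ-fromℕ< _)) (trans (cong toℕ base≡one) (toℕ-fromℕ< (hu a))))
  ... | no a∉i  = trans (∉⇒lookup≡false a∉i) (sym (differ-≡ {o = base a} refl))

  p-positive⇔ : ∀ g h i → 0 < p g h i ⇔ FeasibleTriple (thick u) g h i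
  p-positive⇔ g h i = mk⇔
    (λ p>0 → let (w , r₁ , r₂) = to witnesses p>0 in λ a →
      differ-feasible (thick-reflects a) (base a) (w a) (pt i a)
                      (to InRel⇔ r₁ a) (to InRel⇔ r₂ a) (pt-differs i a))
    (λ feasible → from witnesses (realise feasible))
    where
    witnesses : 0 < p g h i ⇔ ∃ λ w → InRel g base w × InRel h w (pt i)
    witnesses = countPts-positive⇔ (λ w → inRel? g base w ×-dec inRel? h w (pt i))
      (λ w≋w′ (r₁ , r₂) → InRel-resp (λ _ → refl) w≋w′ r₁ , InRel-resp w≋w′ (λ _ → refl) r₂)
    realise : FeasibleTriple (thick u) g h i → ∃ λ w → InRel g base w × InRel h w (pt i)
    realise feasible = proj₁ ∘ pointwise ,
                       from InRel⇔ (proj₁ ∘ proj₂ ∘ pointwise) , from InRel⇔ (proj₂ ∘ proj₂ ∘ pointwise)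
      where
      pointwise : ∀ a → ∃ λ w → lookup g a ≡ differ (base a) w × lookup h a ≡ differ w (pt i a)
      pointwise a =
        feasible-realised (thick-reflects a) (hu a) (base a) (pt i a) (feasible a) (pt-differs i a)

  ⊕-product : ∀ g h → 0 < p g h (g ⊕ h)
  ⊕-product g h = from (p-positive⇔ g h (g ⊕ h)) (FeasibleTriple-⊕ (thick u) g h)

  thinPart-product : ∀ {g h i} → 0 < p g h i → thinPart i ≡ thinPart g ⊕ thinPart h
  thinPart-product {g} {h} {i} = FeasibleTriple-thin ∘ to (p-positive⇔ g h i)

  thickPart-product : ∀ {g h i} → 0 < p g h i →
                      thickPart g ≡ ⊥ → thickPart h ≡ ⊥ → thickPart i ≡ ⊥
  thickPart-product {g} {h} {i} = FeasibleTriple-thick ∘ to (p-positive⇔ g h i)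

  diagonal-product : ∀ {g} → thinPart g ≡ ⊥ → 0 < p g g g
  diagonal-product {g} = from (p-positive⇔ g g g) ∘ FeasibleTriple-diagonal

  split-product : ∀ g → 0 < p (thickPart g) (thinPart g) g
  split-product g =
    subst (λ i → 0 < p (thickPart g) (thinPart g) i) (p∩m⊕p∩∁m≡p g (thick u)) (⊕-product _ _)

  closed⇒R₀ : ∀ {A} → Closed A → T (A R₀)
  closed⇒R₀ ((b , b∈A) , closed) =
    closed ⊥ (b , b , b∈A , b∈A , subst (λ i → 0 < p b b i) (⊕-inverseˡ b) (⊕-product b b))

  thinPart⊥ : thinPart ⊥ ≡ ⊥
  thinPart⊥ = ∩-zeroˡ _

  thickPart⊥ : thickPart ⊥ ≡ ⊥
  thickPart⊥ = ∩-zeroˡ _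

  preimage-stronglyNormalClosed : (U W : RelSet n) → (∀ g → T (U g) ⇔ T (W (thinPart g))) →
    T (W ⊥) → (∀ b c → T (W b) → T (W c) → T (W (b ⊕ c))) → StronglyNormalClosed U
  preimage-stronglyNormalClosed U W U⇔W∘thinPart ⊥∈W W-⊕ = (nonempty , closed) , normal
    where
    module U⇔ g = Equivalence (U⇔W∘thinPart g)
    nonempty : Nonempty U
    nonempty = ⊥ , U⇔.from ⊥ (subst (T ∘ W) (sym thinPart⊥) ⊥∈W)
    closed : ∀ t → (⟦ U ⟧ · ⟦ U ⟧) t → T (U t)
    closed t (g , h , g∈U , h∈U , p>0) = U⇔.from t
      (subst (T ∘ W) (sym (thinPart-product p>0)) (W-⊕ _ _ (U⇔.to g g∈U) (U⇔.to h h∈U)))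
    normal : ∀ g t → ((｛ g ｝ · ⟦ U ⟧) · ｛ g ｝) t → T (U t)
    normal g t (y , _ , (_ , x , refl , x∈U , p₁>0) , refl , p₂>0) =
      U⇔.from t (subst (T ∘ W) conjugate (U⇔.to x x∈U))
      where
      conjugate : thinPart x ≡ thinPart t
      conjugate = begin
        thinPart x                           ≡⟨ p⊕q⊕p≡q (thinPart g) (thinPart x) ⟨
        thinPart g ⊕ thinPart x ⊕ thinPart g ≡⟨ cong (_⊕ thinPart g) (thinPart-product p₁>0) ⟨
        thinPart y ⊕ thinPart g              ≡⟨ thinPart-product p₂>0 ⟨
        thinPart t                           ∎
        where open ≡-Reasoning

  _≟ˢ_ : (g h : Subset n) → Dec (g ≡ h)
  _≟ˢ_ = ≡-dec Bool._≟_

  thinResidue⇔ : ∀ g → Oϑ^ g ⇔ thinPart g ≡ ⊥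
  thinResidue⇔ g = mk⇔ (λ g∈Oϑ^ → toWitness (g∈Oϑ^ thickRelations thickRelations-snc)) g∈Oϑ^
    where
    thickRelations : RelSet n
    thickRelations g = ⌊ thinPart g ≟ˢ ⊥ ⌋
    thickRelations-snc : StronglyNormalClosed thickRelations
    thickRelations-snc =
      preimage-stronglyNormalClosed thickRelations (λ c → ⌊ c ≟ˢ ⊥ ⌋) (λ _ → mk⇔ id id) (fromWitness refl)
        λ b c b≡⊥ c≡⊥ → fromWitness (trans (cong₂ _⊕_ (toWitness b≡⊥) (toWitness c≡⊥)) (⊕-identityˡ ⊥))
    g∈Oϑ^ : thinPart g ≡ ⊥ → Oϑ^ g
    g∈Oϑ^ thin≡⊥ A ((nonempty , closed) , normal) =
      normal g g (g , g , (g , ⊥ , refl , closed⇒R₀ (nonempty , closed) , g∈g·⊥) , refl , g∈g·g)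
      where
      g∈g·⊥ : 0 < p g ⊥ g
      g∈g·⊥ = subst (λ i → 0 < p g ⊥ i) (⊕-identityʳ g) (⊕-product g ⊥)
      g∈g·g : 0 < p g g g
      g∈g·g = diagonal-product thin≡⊥

  thinRadical⇔ : ∀ g → Oϑ_ g ⇔ thickPart g ≡ ⊥
  thinRadical⇔ = valency≡1⇔ hu base

  thickPart∈Oϑ^ : ∀ g → Oϑ^ (thickPart g)
  thickPart∈Oϑ^ g = from (thinResidue⇔ _) (p∩m∩∁m≡⊥ g (thick u))

  module Decomposition (U : RelSet n) (U-snc : StronglyNormalClosed U) where

    V : RelSet n
    V g = U g ∧ ⌊ thickPart g ≟ˢ ⊥ ⌋

    V⇔ : ∀ {g} → T (V g) ⇔ (T (U g) × thickPart g ≡ ⊥)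
    V⇔ = mk⇔ (λ g∈V → let (g∈U , thin) = to T-∧ g∈V in g∈U , toWitness thin)
             (λ (g∈U , thin) → from T-∧ (g∈U , fromWitness thin))

    U-closed : ∀ {g h t} → 0 < p g h t → T (U g) → T (U h) → T (U t)
    U-closed p>0 g∈U h∈U = proj₂ (proj₁ U-snc) _ (_ , _ , g∈U , h∈U , p>0)

    Oϑ^⊆U : ∀ {g} → Oϑ^ g → T (U g)
    Oϑ^⊆U g∈Oϑ^ = g∈Oϑ^ U U-snc

    R₀∈V : T (V R₀)
    R₀∈V = from V⇔ (closed⇒R₀ (proj₁ U-snc) , thickPart⊥)

    thinPart∈V : ∀ {g} → T (U g) → T (V (thinPart g))
    thinPart∈V {g} g∈U =
      from V⇔ (U-closed thinPart∈thickPart·g (Oϑ^⊆U (thickPart∈Oϑ^ g)) g∈U , p∩∁m∩m≡⊥ g (thick u))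
      where
      thinPart∈thickPart·g : 0 < p (thickPart g) g (thinPart g)
      thinPart∈thickPart·g =
        subst (λ i → 0 < p (thickPart g) g i) (p∩m⊕p≡p∩∁m g (thick u)) (⊕-product _ _)

    V-closed : Closed V
    V-closed = (R₀ , R₀∈V) , λ t (b , c , b∈V , c∈V , p>0) →
      let (b∈U , b-thin) = to V⇔ b∈V ; (c∈U , c-thin) = to V⇔ c∈V
      in from V⇔ (U-closed p>0 b∈U c∈U , thickPart-product p>0 b-thin c-thin)

    V⊆Oϑ_ : ∀ g → T (V g) → Oϑ_ g
    V⊆Oϑ_ g = from (thinRadical⇔ g) ∘ proj₂ ∘ to V⇔

    U⇔Oϑ^·V : ∀ g → T (U g) ⇔ (Oϑ^ · ⟦ V ⟧) g
    U⇔Oϑ^·V g = mk⇔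
      (λ g∈U → thickPart g , thinPart g , thickPart∈Oϑ^ g , thinPart∈V g∈U , split-product g)
      (λ (b , c , b∈Oϑ^ , c∈V , p>0) → U-closed p>0 (Oϑ^⊆U b∈Oϑ^) (proj₁ (to V⇔ c∈V)))

    Oϑ^∩V⇔R₀ : ∀ g → (Oϑ^ g × T (V g)) ⇔ (g ≡ R₀)
    Oϑ^∩V⇔R₀ g = mk⇔
      (λ (g∈Oϑ^ , g∈V) → p∩m≡⊥⇒p∩∁m≡⊥⇒p≡⊥ (proj₂ (to V⇔ g∈V)) (to (thinResidue⇔ g) g∈Oϑ^))
      (λ { refl → from (thinResidue⇔ R₀) thinPart⊥ , R₀∈V })

  module Composition (U V : RelSet n) (V-closed : Closed V) (V⊆Oϑ_ : ∀ g → T (V g) → Oϑ_ g)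
                     (U⇔Oϑ^·V : ∀ g → T (U g) ⇔ (Oϑ^ · ⟦ V ⟧) g) where

    thinPart-of-product : ∀ {b c g} → 0 < p b c g → Oϑ^ b → T (V c) → thinPart g ≡ c
    thinPart-of-product {b} {c} {g} p>0 b∈Oϑ^ c∈V = begin
      thinPart g              ≡⟨ thinPart-product p>0 ⟩
      thinPart b ⊕ thinPart c ≡⟨ cong₂ _⊕_ (to (thinResidue⇔ b) b∈Oϑ^) c-thin ⟩
      ⊥ ⊕ c                   ≡⟨ ⊕-identityˡ c ⟩
      c                       ∎
      where
      open ≡-Reasoning
      c-thin : thinPart c ≡ c
      c-thin = p∩m≡⊥⇒p∩∁m≡p (to (thinRadical⇔ c) (V⊆Oϑ_ c c∈V))

    U⇔V∘thinPart : ∀ g → T (U g) ⇔ T (V (thinPart g))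
    U⇔V∘thinPart g = mk⇔
      (λ g∈U → let (_ , c , b∈Oϑ^ , c∈V , p>0) = to (U⇔Oϑ^·V g) g∈U
               in subst (T ∘ V) (sym (thinPart-of-product p>0 b∈Oϑ^ c∈V)) c∈V)
      (λ thinPart∈V →
        from (U⇔Oϑ^·V g) (thickPart g , thinPart g , thickPart∈Oϑ^ g , thinPart∈V , split-product g))

    U-snc : StronglyNormalClosed U
    U-snc = preimage-stronglyNormalClosed U V U⇔V∘thinPart (closed⇒R₀ V-closed)
      (λ b c b∈V c∈V → proj₂ V-closed (b ⊕ c) (b , c , b∈V , c∈V , ⊕-product b c))

theorem3p17 : (n : ℕ) → 1 ≤ n → (u : Fin n → ℕ) → (hu : ∀ a → 2 ≤ u a) →
    let open Scheme n u hu in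
    (U : RelSet n) →
      StronglyNormalClosed U ⇔
      Σ (RelSet n) (λ V →
        Closed V
        × (∀ g → T (V g) → Oϑ_ g)
        × (∀ g → T (U g) ⇔ (Oϑ^ · ⟦ V ⟧) g)
        × (∀ g → (Oϑ^ g × T (V g)) ⇔ (g ≡ R₀)))
theorem3p17 n _ u hu U = mk⇔
  (λ U-snc → let open Decomposition U U-snc in V , V-closed , V⊆Oϑ_ , U⇔Oϑ^·V , Oϑ^∩V⇔R₀)
  (λ (V , V-closed , V⊆Oϑ_ , U⇔Oϑ^·V , _) → Composition.U-snc U V V-closed V⊆Oϑ_ U⇔Oϑ^·V)
  where open FactorialScheme n u hu
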